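{- Let $N=(S,T,F)$ be a Petri net, $m,m'$ markings, $\Omega$ a total order on $\mathbb{N}^T$ as in the context, and $\Gamma$ a finite family of jump and increment constraints. Let $\mathcal{S}\subseteq\mathbb{N}^T$ be the set of solutions of the state equation $m+Cx=m'$ that satisfy all constraints of $\Gamma$, and let $B$ be the set of componentwise-minimal elements of $\mathcal{S}$. Let $b,b'\in B$ and assume $b$ is the $\Omega$-smallest element of $\mathcal{S}$. Then there exist finitely many jump constraints $t_1<n_1,\dots,t_k<n_k$ ($k\ge 0$, $t_i\in T$, $n_i\in\mathbb{N}$) such that $b'$ is the $\Omega$-smallest solution of the state equation $m+Cx=m'$ satisfying all constraints of $\Gamma$ together with $t_1<n_1,\dots,t_k<n_k$.
   Context: A Petri net is $N=(S,T,F)$ with finite disjoint nonempty sets $S$ (places), $T$ (transitions) and $F\colon (S\times T)\cup(T\times S)\to\mathbb{N}$; markings are maps $S\to\mathbb{N}$. The incidence matrix is $C_{s,t}=F(t,s)-F(s,t)$ and the state equation is $m+Cx=m'$, $x\in\mathbb{N}^T$. A jump constraint is an inequality $t<n$ with $t\in T$, $n\in\mathbb{N}$; an increment constraint is an inequality $\sum_{i=1}^k n_i t_i\ge n$ with $n_i\in\mathbb{Z}$, $n\in\mathbb{N}$, $t_i\in T$; a vector $x\in\mathbb{N}^T$ satisfies a constraint if the inequality holds after substituting $x(t)$ for each $t$. $\Omega$ is a fixed total order on $\mathbb{N}^T$ such that $\sum_t x(t)<\sum_t y(t)$ implies $x<_\Omega y$. -}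

module Defs where

open import Data.Nat as ℕ using (ℕ; suc)
open import Data.Integer as ℤ using (ℤ; +_)
open import Data.Fin using (Fin)
open import Data.List using (List; []; _∷_)
open import Data.List.Relation.Unary.All using (All)
open import Data.Product using (_×_; _,_)
open import Data.Unit using (⊤)
open import Relation.Binary.PropositionalEquality using (_≡_; _≗_)
open import Relation.Binary.Structures using (IsStrictTotalOrder)
open import Relation.Nullary using (¬_)

sumℕ : ∀ {n} → (Fin n → ℕ) → ℕ
sumℕ {ℕ.zero} f = 0
sumℕ {suc n} f = f Data.Fin.zero ℕ.+ sumℕ (λ i → f (Data.Fin.suc i))

sumℤ : ∀ {n} → (Fin n → ℤ) → ℤ
sumℤ {ℕ.zero} f = + 0
sumℤ {suc n} f = f Data.Fin.zero ℤ.+ sumℤ (λ i → f (Data.Fin.suc i))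

-- A Petri net with places S = Fin (suc p) and transitions T = Fin (suc q)
-- (finite, nonempty); disjointness is automatic since they are separate types.
record PetriNet (p q : ℕ) : Set where
  field
    pre  : Fin (suc p) → Fin (suc q) → ℕ   -- F(s,t)
    post : Fin (suc q) → Fin (suc p) → ℕ   -- F(t,s)

module _ {p q : ℕ} where

  Place = Fin (suc p)
  Trans = Fin (suc q)

  Marking : Set
  Marking = Place → ℕ

  NT : Set
  NT = Trans → ℕ

  incidence : PetriNet p q → Place → Trans → ℤ
  incidence N s t = + PetriNet.post N t s ℤ.- + PetriNet.pre N s t

  StateEq : PetriNet p q → Marking → Marking → NT → Set
  StateEq N m m' x =
    ∀ s → + m s ℤ.+ sumℤ (λ t → incidence N s t ℤ.* + x t) ≡ + m' s

  data Constraint : Set where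
    jump : Trans → ℕ → Constraint
    incr : List (ℤ × Trans) → ℕ → Constraint

  lhs : List (ℤ × Trans) → NT → ℤ
  lhs [] x = + 0
  lhs ((a , t) ∷ cs) x = a ℤ.* + x t ℤ.+ lhs cs x

  Sat : NT → Constraint → Set
  Sat x (jump t n) = x t ℕ.< n
  Sat x (incr cs n) = + n ℤ.≤ lhs cs x

  SatAll : List Constraint → NT → Set
  SatAll Γ x = All (Sat x) Γ

  Sol : PetriNet p q → Marking → Marking → List Constraint → NT → Set
  Sol N m m' Γ x = StateEq N m m' x × SatAll Γ x

  _≤ᶜ_ : NT → NT → Set
  x ≤ᶜ y = ∀ t → x t ℕ.≤ y t

  Minimal : (NT → Set) → NT → Set
  Minimal P x = P x × (∀ y → P y → y ≤ᶜ x → y ≗ x)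

  Smallest : (NT → NT → Set) → (NT → Set) → NT → Set
  Smallest _<Ω_ P x = P x × (∀ y → P y → ¬ (y ≗ x) → x <Ω y)

  record IsOmega (_<Ω_ : NT → NT → Set) : Set₁ where
    field
      isSTO   : IsStrictTotalOrder _≗_ _<Ω_
      sumMono : ∀ x y → sumℕ x ℕ.< sumℕ y → x <Ω y

module Submission where

-- Impose on every transition t the jump constraint t < b'(t) + 1.
-- A vector satisfying all of these is componentwise below b', so a solution of
-- the enlarged system is a solution of the original one lying below b'; as b'
-- is componentwise minimal among those, it coincides with b'.  Hence b' is the
-- unique solution of the enlarged system, and a unique element is trivially
-- the smallest one for any order whatsoever (in particular for Ω).
--
-- The theorem follows by
-- taking the box constraints of b' as the extra constraints.

open import Defs
open import Data.Nat using (ℕ; suc)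
open import Data.Nat.Properties using (≤-refl; ≤-pred)
open import Data.List using (List; _++_; map; allFin)
open import Data.List.Relation.Unary.All as All using (All)
open import Data.List.Relation.Unary.All.Properties using (map⁺; map⁻; ++⁺; ++⁻ˡ; ++⁻ʳ)
open import Data.List.Membership.Propositional.Properties using (∈-allFin)
open import Data.Product using (Σ; _×_; _,_; uncurry)
open import Relation.Binary.PropositionalEquality using (_≗_)
open import Relation.Nullary using (contradiction)

-- The number of places p does not occur in NT or Trans, so it cannot be
-- inferred from them and is passed explicitly where needed.
module _ {p q : ℕ} where

  box : NT {p} {q} → List (Trans {p} {q} × ℕ)
  box x = map (λ t → (t , suc (x t))) (allFin (suc q))

  jumps : List (Trans {p} {q} × ℕ) → List (Constraint {p} {q})
  jumps = map (uncurry jump)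

  box-sat : (x : NT {p} {q}) → SatAll {p} {q} (jumps (box x)) x
  box-sat x = map⁺ (map⁺ (All.tabulate (λ _ → ≤-refl)))

  box-≤ᶜ : (x y : NT {p} {q}) → SatAll {p} {q} (jumps (box x)) y → _≤ᶜ_ {p} {q} y x
  box-≤ᶜ x y sat t = ≤-pred (All.lookup (map⁻ (map⁻ sat)) (∈-allFin t))

  unique⇒smallest : (_<Ω_ : NT {p} {q} → NT {p} {q} → Set) (P : NT {p} {q} → Set)
    (x : NT {p} {q}) → P x → (∀ y → P y → y ≗ x) → Smallest {p} {q} _<Ω_ P x
  unique⇒smallest _ _ _ px unique = px , λ y py y≉x → contradiction (unique y py) y≉x

  minimal⇒unique-in-box : (N : PetriNet p q) (m m' : Marking {p} {q})
    (Γ : List (Constraint {p} {q})) (x : NT {p} {q}) → Minimal {p} {q} (Sol {p} {q} N m m' Γ) x →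
    ∀ y → Sol {p} {q} N m m' (Γ ++ jumps (box x)) y → y ≗ x
  minimal⇒unique-in-box N m m' Γ x (_ , minimal) y (se , sat) =
    minimal y (se , ++⁻ˡ Γ sat) (box-≤ᶜ x y (++⁻ʳ Γ sat))

lemma4p1 : {p q : ℕ} (N : PetriNet p q) (m m' : Marking {p} {q})
    (_<Ω_ : NT {p} {q} → NT {p} {q} → Set) → IsOmega {p} {q} _<Ω_ →
    (Γ : List (Constraint {p} {q})) (b b' : NT {p} {q}) →
    Minimal {p} {q} (Sol N m m' Γ) b → Minimal {p} {q} (Sol N m m' Γ) b' →
    Smallest {p} {q} _<Ω_ (Sol N m m' Γ) b →
    Σ (List (Trans {p} {q} × ℕ)) λ J →
    Smallest {p} {q} _<Ω_ (Sol N m m' (Γ ++ map (uncurry (jump {p} {q})) J)) b'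
lemma4p1 {p} {q} N m m' _<Ω_ _ Γ _ b' _ minimal-b'@((se , sat) , _) _ =
  J , unique⇒smallest {p} {q} _<Ω_ (Sol N m m' (Γ ++ jumps J)) b'
        b'-solves (minimal⇒unique-in-box N m m' Γ b' minimal-b')
  where
  J : List (Trans {p} {q} × ℕ)
  J = box {p} b'

  b'-solves : Sol N m m' (Γ ++ jumps J) b'
  b'-solves = se , ++⁺ sat (box-sat {p} b')
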